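{- Let $\omega$ be a finite permutation of length $l\ge 1$ with natural word $\eta=\eta_1\cdots\eta_l$, and let $\omega'=\omega s_{\eta_l}$. Then: (1) $\mathcal T_{\omega'}$ is obtained from $\mathcal T_\omega$ by removing the cell labelled $l$ in the natural labelling of $\mathcal T_\omega$; (2) if $\mathcal U$ (resp. $\mathcal U'$) denotes the tower diagram obtained from $\varnothing$ by successively sliding $\eta_l,\eta_{l-1},\dots,\eta_1$ (resp. $\eta_{l-1},\dots,\eta_1$), then $\mathcal U'$ is obtained from $\mathcal U$ by removing the cell $(\eta_l,0)$ (the cell created by the first slide, labelled $1$) and shifting the remaining cells of tower $\eta_l$ to the next tower, i.e. $\mathcal U'=\{(a,b)\in\mathcal U: a\neq\eta_l\}\cup\{(\eta_l+1,b-1):(\eta_l,b)\in\mathcal U,\ b\ge 1\}$.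
   Context: $s_i=(i,i+1)$; permutations compose as functions; a reduced word of $\omega$ is a word $\alpha_1\cdots\alpha_\ell$ with $\omega=s_{\alpha_1}\cdots s_{\alpha_\ell}$ and $\ell=\ell(\omega)$ minimal. A cell is a pair $(i,j)$ of integers with $i\ge 1$, $j\ge 0$. A tower diagram is a finite set $\mathcal T$ of cells such that $(i,j)\in\mathcal T$ and $0\le k\le j$ imply $(i,k)\in\mathcal T$; its $i$-th tower consists of its cells with first coordinate $i$. The cell $(i,j)$ lies on the diagonal $x+y=i+j$. Flight paths (recursive): a cell $(i,j)\in\mathcal T$ has a flight path in $\mathcal T$ if either (F1) there is no cell $(i',j')\in\mathcal T$ with $i'<i$ and $i'+j'=i+j-1$ (flight path $\{(i,j)\}$), or (F2) such cells exist and, letting $(i',j')$ be the one with largest $i'$, $(i',j')$ has a flight path and $(i',j'+1)\in\mathcal T$ (flight path $\{(i,j),(i',j'+1)\}\cup\mathrm{flightpath}((i',j'),\mathcal T)$). The flight number of such a cell is $a+b$ for $(a,b)$ the lexicographically smallest element of its flight path. Sliding: for a positive integer $\alpha$, $\alpha^{\searrow}\mathcal T$ is computed by the procedure $P(\gamma,m)$ started at $\gamma=\alpha$, $m=1$: (S1) if no cell $(i,j)\in\mathcal T$ with $i\ge m$ lies on $x+y=\gamma-1$: (a) if $(\gamma,0)\notin\mathcal T$ the result is $\mathcal T\cup\{(\gamma,0)\}$; (b) if $(\gamma,0)\in\mathcal T$, $(\gamma,1)\notin\mathcal T$ the slide terminates (without result); (c) if $(\gamma,0),(\gamma,1)\in\mathcal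 T$, continue with $P(\gamma+1,\gamma+1)$. (S2) Otherwise let $i\ge m$ be smallest with $(i,\gamma-1-i)\in\mathcal T$: (a) if $(i,\gamma-i)\notin\mathcal T$ the result is $\mathcal T\cup\{(i,\gamma-i)\}$; (b) if $(i,\gamma-i)\in\mathcal T$, $(i,\gamma-i+1)\notin\mathcal T$ the slide terminates; (c) if both are in $\mathcal T$, continue with $P(\gamma+1,i+1)$. The tower diagram $\mathcal T_\omega$ of $\omega$ is obtained from $\varnothing$ by successively sliding the letters of any reduced word of $\omega$ (independent of the choice). The natural labelling of $\mathcal T_\omega$ (with $n$ cells) labels the cells $1,\dots,n$ starting with the rightmost nonempty tower from bottom to top, then the next nonempty tower to its left from bottom to top, and so on. The natural word $\eta$ of $\omega$ is the reading word of this labelling: its $k$-th letter is the flight number of the cell labelled $k$ in the diagram formed by the cells labelled $1,\dots,k$. Equivalently, if the nonempty towers of $\mathcal T_\omega$ are at positions $i_1>\dots>i_s$ with heights $h_1,\dots,h_s$, then $\eta=(i_1,\dots,i_1+h_1-1)\cdots(i_s,\dots,i_s+h_s-1)$; it is a reduced word of $\omega$. -}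

module Defs where

open import Data.Nat using (ℕ; zero; suc; _+_; _≤_; _<_; _≡ᵇ_)
open import Data.Bool using (if_then_else_)
open import Data.Product using (_×_; _,_; proj₁; proj₂)
open import Data.List using (List; []; _∷_; _++_; map; upTo; length)
open import Data.List.Relation.Unary.All using (All)
open import Data.Maybe using (Maybe; just; nothing)
open import Relation.Binary.PropositionalEquality using (_≡_)
open import Relation.Nullary using (¬_)

Word : Set
Word = List ℕ

swap : ℕ → ℕ → ℕ
swap a n = if n ≡ᵇ a then suc a else (if n ≡ᵇ suc a then a else n)

act : Word → ℕ → ℕ
act []      n = n
act (a ∷ w) n = swap a (act w n)

PositiveLetters : Word → Set
PositiveLetters = All (λ a → 1 ≤ a)

Represents : (ℕ → ℕ) → Word → Set
Represents ω w = ∀ n → act w n ≡ ω n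

ReducedWord : (ℕ → ℕ) → Word → Set
ReducedWord ω w =
  PositiveLetters w × Represents ω w ×
  (∀ v → PositiveLetters v → Represents ω v → length w ≤ length v)

Cell : Set
Cell = ℕ × ℕ

-- A tower diagram is encoded by its list of tower heights:
-- the k-th entry (0-based) is the height of tower k+1; towers beyond
-- the list are empty.  Tower i consists of the cells (i,0),…,(i,h-1).
Diagram : Set
Diagram = List ℕ

heightAt : List ℕ → ℕ → ℕ
heightAt []      _       = 0
heightAt (h ∷ _) zero    = h
heightAt (_ ∷ T) (suc k) = heightAt T k

-- height of tower i (towers are indexed from 1; "tower 0" is empty)
height : Diagram → ℕ → ℕ
height T zero    = 0
height T (suc k) = heightAt T k

_∈ᵀ_ : Cell → Diagram → Set
(i , j) ∈ᵀ T = j < height T i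

∅ᵀ : Diagram
∅ᵀ = []

growAt : List ℕ → ℕ → List ℕ
growAt []      zero    = 1 ∷ []
growAt []      (suc k) = 0 ∷ growAt [] k
growAt (h ∷ T) zero    = suc h ∷ T
growAt (h ∷ T) (suc k) = h ∷ growAt T k

grow : Diagram → ℕ → Diagram
grow T zero    = T
grow T (suc k) = growAt T k

-- Sliding: the procedure P(γ,m) as an inductive relation
-- Slide T γ m T'  means "P(γ,m) run on T has result T'".
-- (Cases (S1b),(S2b), where the slide terminates without result, have no
-- constructor.)  The diagonal x+y = γ-1 is written suc (x + y) ≡ γ.

NoCellOnDiag : Diagram → ℕ → ℕ → Set
NoCellOnDiag T γ m = ∀ i j → m ≤ i → suc (i + j) ≡ γ → ¬ ((i , j) ∈ᵀ T)

FirstOnDiag : Diagram → ℕ → ℕ → ℕ → ℕ → Set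
FirstOnDiag T γ m i j =
  m ≤ i × suc (i + j) ≡ γ × (i , j) ∈ᵀ T ×
  (∀ k j' → m ≤ k → k < i → suc (k + j') ≡ γ → ¬ ((k , j') ∈ᵀ T))

data Slide (T : Diagram) : ℕ → ℕ → Diagram → Set where
  s1a : ∀ {γ m} → NoCellOnDiag T γ m → ¬ ((γ , 0) ∈ᵀ T) →
        Slide T γ m (grow T γ)
  s1c : ∀ {γ m T'} → NoCellOnDiag T γ m → (γ , 0) ∈ᵀ T → (γ , 1) ∈ᵀ T →
        Slide T (suc γ) (suc γ) T' → Slide T γ m T'
  s2a : ∀ {γ m i j} → FirstOnDiag T γ m i j → ¬ ((i , suc j) ∈ᵀ T) →
        Slide T γ m (grow T i)
  s2c : ∀ {γ m i j T'} → FirstOnDiag T γ m i j →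
        (i , suc j) ∈ᵀ T → (i , suc (suc j)) ∈ᵀ T →
        Slide T (suc γ) (suc i) T' → Slide T γ m T'

data SlidesFrom : Diagram → Word → Diagram → Set where
  done : ∀ {T} → SlidesFrom T [] T
  step : ∀ {T T₁ T₂ a w} → Slide T a 1 T₁ → SlidesFrom T₁ w T₂ →
         SlidesFrom T (a ∷ w) T₂

Slides : Word → Diagram → Set
Slides w U = SlidesFrom ∅ᵀ w U

towerCells : ℕ → ℕ → List Cell
towerCells i h = map (λ j → (i , j)) (upTo h)

labellingFrom : ℕ → List ℕ → List Cell
labellingFrom k []      = []
labellingFrom k (h ∷ T) = labellingFrom (suc k) T ++ towerCells k h

-- the natural labelling: element at position p carries label p+1
naturalLabelling : Diagram → List Cell
naturalLabelling T = labellingFrom 1 T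

-- the k-th element (1-based) of a list
at : {A : Set} → List A → ℕ → Maybe A
at xs        zero          = nothing
at []        (suc k)       = nothing
at (x ∷ xs)  (suc zero)    = just x
at (x ∷ xs)  (suc (suc k)) = at xs (suc k)

cellLabelled : Diagram → ℕ → Maybe Cell
cellLabelled T k = at (naturalLabelling T) k

-- natural word: (i₁,…,i₁+h₁-1)⋯(i_s,…,i_s+h_s-1), i.e. the letter of the
-- cell (i,j) in the labelling order is i+j
naturalWord : Diagram → Word
naturalWord T = map (λ c → proj₁ c + proj₂ c) (naturalLabelling T)

-- Write π(w) for the permutation s_{w₁} ⋯ s_{w_k} of a word w.  Sliding a letter γ into a
-- diagram multiplies π of its natural word on the right by s_γ: the towers passed over commute
-- with s_γ, the grown tower takes it as its new top letter, and each tower left behind by a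
-- recursive step (S1c)/(S2c) conjugates s_{γ+1} back into s_γ by a braid relation.  Hence the
-- natural word of the diagram of w represents π(w).  Conversely a diagram is determined by π of
-- its natural word: peeling towers from the left, the height of tower k is the point sent to k.
--
-- The natural word of T ends with η_l, the letter of the last-labelled cell c, so ω s_{η_l} is
-- represented by the natural word of T without c, which gives (1).  For (2), π of the natural
-- word of U is s_{η_l} times that of U'.  Since the leftmost tower of T without c has top
-- letter η_l, ρ = π(natural word of T without c) satisfies ρ(η_l) < ρ(j) for all j > η_l, and
-- this forbids a nonempty tower η_l in U', whose natural word represents ρ⁻¹.  Left
-- multiplying by s_{η_l} then lays tower η_l + 1 of U', with one extra cell, onto tower η_l.

module Submission where

open import Defs
open import Data.Nat
open import Data.Nat.Properties
open import Data.Bool using (true; false)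
open import Data.Bool.Properties using (T-≡)
open import Data.Product using (Σ; _×_; _,_; proj₁; proj₂)
open import Data.Sum using (_⊎_; inj₁; inj₂)
open import Data.List using (List; []; _∷_; _++_; map; length; reverse; take; upTo; applyUpTo)
open import Data.List.Properties using (++-assoc; ++-identityˡ; ++-identityʳ; length-++; length-map; length-upTo; map-++; map-∘; map-upTo; upTo-∷ʳ; reverse-++; unfold-reverse; reverse-involutive)
open import Data.List.Relation.Unary.All using (All; []; _∷_)
import Data.List.Relation.Unary.All as All
open import Data.List.Relation.Unary.All.Properties using (++⁺)
open import Data.Empty using (⊥-elim)
open import Data.Maybe using (just)
open import Data.Nat.ListAction using (sum)
open import Function.Base using (_∘_)
open import Function.Bundles using (Equivalence; _⇔_; mk⇔)
open import Relation.Binary.PropositionalEquality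
open import Relation.Nullary using (¬_; yes; no)

-- Simple transpositions

≡ᵇ-true : ∀ {m n} → m ≡ n → (m ≡ᵇ n) ≡ true
≡ᵇ-true {m} {n} m≡n = Equivalence.to T-≡ (≡⇒≡ᵇ m n m≡n)

≡ᵇ-false : ∀ {m n} → m ≢ n → (m ≡ᵇ n) ≡ false
≡ᵇ-false {m} {n} m≢n with m ≡ᵇ n in eq
... | true  = ⊥-elim (m≢n (≡ᵇ⇒≡ m n (Equivalence.from T-≡ eq)))
... | false = refl

swap-self : ∀ a → swap a a ≡ suc a
swap-self a rewrite ≡ᵇ-true (refl {x = a}) = refl

swap-suc : ∀ a → swap a (suc a) ≡ a
swap-suc a rewrite ≡ᵇ-false (1+n≢n {a}) | ≡ᵇ-true (refl {x = suc a}) = refl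

swap-other : ∀ a n → n ≢ a → n ≢ suc a → swap a n ≡ n
swap-other a n n≢a n≢1+a rewrite ≡ᵇ-false n≢a | ≡ᵇ-false n≢1+a = refl

swap-below : ∀ a n → n < a → swap a n ≡ n
swap-below a n n<a = swap-other a n (<⇒≢ n<a) (<⇒≢ (m<n⇒m<1+n n<a))

swap-above : ∀ a n → suc a < n → swap a n ≡ n
swap-above a n 1+a<n = swap-other a n (>⇒≢ (<-trans (n<1+n a) 1+a<n)) (>⇒≢ 1+a<n)

data SwapCase (a n : ℕ) : Set where
  at-a     : n ≡ a → SwapCase a n
  at-suc-a : n ≡ suc a → SwapCase a n
  elsewhere : n ≢ a → n ≢ suc a → SwapCase a n

swapCase : ∀ a n → SwapCase a n
swapCase a n with n ≟ a | n ≟ suc a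
... | yes n≡a | _         = at-a n≡a
... | no _    | yes n≡1+a = at-suc-a n≡1+a
... | no n≢a  | no n≢1+a  = elsewhere n≢a n≢1+a

swap-involutive : ∀ a n → swap a (swap a n) ≡ n
swap-involutive a n with swapCase a n
... | at-a refl rewrite swap-self a = swap-suc a
... | at-suc-a refl rewrite swap-suc a = swap-self a
... | elsewhere n≢a n≢1+a rewrite swap-other a n n≢a n≢1+a = swap-other a n n≢a n≢1+a

swap-comm : ∀ a g n → suc a < g → swap a (swap g n) ≡ swap g (swap a n)
swap-comm a g n 1+a<g with swapCase g n
... | at-a refl
  rewrite swap-self g | swap-above a (suc g) (m<n⇒m<1+n 1+a<g) | swap-above a g 1+a<g = sym (swap-self g)
... | at-suc-a refl
  rewrite swap-suc g | swap-above a (suc g) (m<n⇒m<1+n 1+a<g) | swap-above a g 1+a<g = sym (swap-suc g)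
... | elsewhere n≢g n≢1+g with swapCase a n
...   | at-a refl
  rewrite swap-other g a n≢g n≢1+g | swap-self a = sym (swap-below g (suc a) 1+a<g)
...   | at-suc-a refl
  rewrite swap-other g (suc a) n≢g n≢1+g | swap-suc a = sym (swap-below g a (<-trans (n<1+n a) 1+a<g))
...   | elsewhere n≢a n≢1+a
  rewrite swap-other g n n≢g n≢1+g | swap-other a n n≢a n≢1+a = sym (swap-other g n n≢g n≢1+g)

swap-braid : ∀ a n → swap a (swap (suc a) (swap a n)) ≡ swap (suc a) (swap a (swap (suc a) n))
swap-braid a n with swapCase a n
... | at-a refl
  rewrite swap-self a | swap-self (suc a) | swap-above a (suc (suc a)) ≤-refl
        | swap-below (suc a) a (n<1+n a) | swap-self a = sym (swap-self (suc a))
... | at-suc-a refl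
  rewrite swap-suc a | swap-below (suc a) a (n<1+n a) | swap-self a
        | swap-self (suc a) | swap-above a (suc (suc a)) ≤-refl = sym (swap-suc (suc a))
... | elsewhere n≢a n≢1+a with swapCase (suc a) n
...   | at-a n≡1+a = ⊥-elim (n≢1+a n≡1+a)
...   | at-suc-a refl
  rewrite swap-above a (suc (suc a)) ≤-refl | swap-suc (suc a) | swap-suc a = sym (swap-below (suc a) a (n<1+n a))
...   | elsewhere n≢1+a' n≢2+a
  rewrite swap-other a n n≢a n≢1+a | swap-other (suc a) n n≢1+a' n≢2+a | swap-other a n n≢a n≢1+a = sym (swap-other (suc a) n n≢1+a' n≢2+a)

Far : ℕ → ℕ → Set
Far g a = suc a < g ⊎ suc g < a

swap-comm-far : ∀ a g n → Far g a → swap a (swap g n) ≡ swap g (swap a n)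
swap-comm-far a g n (inj₁ 1+a<g) = swap-comm a g n 1+a<g
swap-comm-far a g n (inj₂ 1+g<a) = sym (swap-comm g a n 1+g<a)

swap-preserves-lower-bound : ∀ a i n → i < a → i < n → i < swap a n
swap-preserves-lower-bound a i n i<a i<n with swapCase a n
... | at-a refl rewrite swap-self a = m<n⇒m<1+n i<a
... | at-suc-a refl rewrite swap-suc a = i<a
... | elsewhere n≢a n≢1+a rewrite swap-other a n n≢a n≢1+a = i<n

act-++ : ∀ v w n → act (v ++ w) n ≡ act v (act w n)
act-++ []      w n = refl
act-++ (a ∷ v) w n = cong (swap a) (act-++ v w n)

act-reverseˡ : ∀ w n → act (reverse w) (act w n) ≡ n
act-reverseˡ []      n = refl
act-reverseˡ (a ∷ w) n = begin
  act (reverse (a ∷ w)) (swap a (act w n))      ≡⟨ cong (λ v → act v (swap a (act w n))) (unfold-reverse a w) ⟩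
  act (reverse w ++ a ∷ []) (swap a (act w n))  ≡⟨ act-++ (reverse w) (a ∷ []) _ ⟩
  act (reverse w) (swap a (swap a (act w n)))   ≡⟨ cong (act (reverse w)) (swap-involutive a _) ⟩
  act (reverse w) (act w n)                     ≡⟨ act-reverseˡ w n ⟩
  n                                             ∎
  where open ≡-Reasoning

act-reverseʳ : ∀ w n → act w (act (reverse w) n) ≡ n
act-reverseʳ w n =
  subst (λ v → act v (act (reverse w) n) ≡ n) (reverse-involutive w) (act-reverseˡ (reverse w) n)

act-injective : ∀ w {m n} → act w m ≡ act w n → m ≡ n
act-injective w {m} {n} eq =
  trans (sym (act-reverseˡ w m)) (trans (cong (act (reverse w)) eq) (act-reverseˡ w n))

act-fix-below : ∀ w n → All (n <_) w → act w n ≡ n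
act-fix-below []      n []           = refl
act-fix-below (a ∷ w) n (n<a ∷ n<w) rewrite act-fix-below w n n<w = swap-below a n n<a

act-fix-above : ∀ w n → All (λ a → suc a < n) w → act w n ≡ n
act-fix-above []      n []             = refl
act-fix-above (a ∷ w) n (1+a<n ∷ 1+w<n) rewrite act-fix-above w n 1+w<n = swap-above a n 1+a<n

act-swap-comm : ∀ w g n → All (Far g) w → act w (swap g n) ≡ swap g (act w n)
act-swap-comm []      g n []         = refl
act-swap-comm (a ∷ w) g n (far ∷ fars) rewrite act-swap-comm w g n fars = swap-comm-far a g (act w n) far

act-preserves-lower-bound : ∀ w i n → All (i <_) w → i < n → i < act w n
act-preserves-lower-bound []      i n []           i<n = i<n
act-preserves-lower-bound (a ∷ w) i n (i<a ∷ i<w) i<n =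
  swap-preserves-lower-bound a i (act w n) i<a (act-preserves-lower-bound w i n i<w i<n)

All-reverse : ∀ {P : ℕ → Set} {w} → All P w → All P (reverse w)
All-reverse {P} {[]}    []       = []
All-reverse {P} {a ∷ w} (p ∷ ps) = subst (All P) (sym (unfold-reverse a w)) (++⁺ (All-reverse ps) (p ∷ []))

-- Words of towers

towerWord : ℕ → ℕ → Word
towerWord k zero    = []
towerWord k (suc h) = k ∷ towerWord (suc k) h

towerWord-All : ∀ {P : ℕ → Set} k h → (∀ j → j < h → P (k + j)) → All P (towerWord k h)
towerWord-All         k zero    f = []
towerWord-All {P = P} k (suc h) f =
  subst P (+-identityʳ k) (f 0 z<s) ∷ towerWord-All (suc k) h (λ j j<h → subst P (+-suc k j) (f (suc j) (s<s j<h)))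

towerWord-above : ∀ k h → All (k <_) (towerWord (suc k) h)
towerWord-above k h = towerWord-All (suc k) h (λ j _ → s≤s (m≤m+n k j))

towerWord-snoc : ∀ k h → towerWord k (suc h) ≡ towerWord k h ++ (k + h ∷ [])
towerWord-snoc k zero    = cong (_∷ []) (sym (+-identityʳ k))
towerWord-snoc k (suc h) = cong (k ∷_) (trans (towerWord-snoc (suc k) h) (cong (λ x → towerWord (suc k) h ++ x ∷ []) (sym (+-suc k h))))

act-towerWord-top : ∀ k h → act (towerWord k h) (k + h) ≡ k
act-towerWord-top k zero    = +-identityʳ k
act-towerWord-top k (suc h) rewrite +-suc k h = trans (cong (swap k) (act-towerWord-top (suc k) h)) (swap-suc k)

act-towerWord-bottom : ∀ k h → 1 ≤ h → act (towerWord k h) k ≡ suc k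
act-towerWord-bottom k (suc h) _ = trans (cong (swap k) (act-fix-below _ k (towerWord-above k h))) (swap-self k)

act-towerWord-fix-above : ∀ k h n → k + h < n → act (towerWord k h) n ≡ n
act-towerWord-fix-above k h n k+h<n = act-fix-above (towerWord k h) n
  (towerWord-All k h (λ j j<h → ≤-<-trans (subst (_≤ k + h) (+-suc k j) (+-monoʳ-≤ k j<h)) k+h<n))

act-towerWord-braid : ∀ k h g n → k ≤ g → 2 + g ≤ k + h →
  act (towerWord k h) (swap g n) ≡ swap (suc g) (act (towerWord k h) n)
act-towerWord-braid k zero g n k≤g g+2≤k rewrite +-identityʳ k =
  ⊥-elim (<-irrefl refl (≤-trans (m<n⇒m<1+n ≤-refl) (≤-trans g+2≤k k≤g)))
act-towerWord-braid k (suc h) g n k≤g g+2≤k+h with m≤n⇒m<n∨m≡n k≤g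
... | inj₁ k<g = begin
  swap k (act (towerWord (suc k) h) (swap g n))
    ≡⟨ cong (swap k) (act-towerWord-braid (suc k) h g n k<g (subst (2 + g ≤_) (+-suc k h) g+2≤k+h)) ⟩
  swap k (swap (suc g) (act (towerWord (suc k) h) n))
    ≡⟨ swap-comm k (suc g) (act (towerWord (suc k) h) n) (s≤s k<g) ⟩
  swap (suc g) (swap k (act (towerWord (suc k) h) n)) ∎
  where open ≡-Reasoning
... | inj₂ refl with h
...   | zero = ⊥-elim (<-irrefl refl (subst (2 + k ≤_) (+-comm k 1) g+2≤k+h))
...   | suc h = begin
  swap k (swap (suc k) (act (towerWord (2 + k) h) (swap k n)))
    ≡⟨ cong (λ x → swap k (swap (suc k) x)) (act-swap-comm (towerWord (2 + k) h) k n
         (All.map inj₂ (towerWord-above (suc k) h))) ⟩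
  swap k (swap (suc k) (swap k (act (towerWord (2 + k) h) n)))
    ≡⟨ swap-braid k (act (towerWord (2 + k) h) n) ⟩
  swap (suc k) (swap k (swap (suc k) (act (towerWord (2 + k) h) n))) ∎
  where open ≡-Reasoning

act-reverse-towerWord-≥ : ∀ k h a → k < a → k ≤ act (reverse (towerWord k h)) a
act-reverse-towerWord-≥ k zero    a k<a = <⇒≤ k<a
act-reverse-towerWord-≥ k (suc h) a k<a
  rewrite unfold-reverse k (towerWord (suc k) h) | act-++ (reverse (towerWord (suc k) h)) (k ∷ []) a
  with m≤n⇒m<n∨m≡n k<a
... | inj₂ refl rewrite swap-suc k | act-fix-below _ k (All-reverse (towerWord-above k h)) = ≤-refl
... | inj₁ 1+k<a rewrite swap-above k a 1+k<a = <⇒≤ (act-reverse-towerWord-≥ (suc k) h a 1+k<a)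

act-reverse-towerWord-monotone : ∀ k h a b → k < a → a < b →
  act (reverse (towerWord k h)) a < act (reverse (towerWord k h)) b
act-reverse-towerWord-monotone k zero    a b k<a a<b = a<b
act-reverse-towerWord-monotone k (suc h) a b k<a a<b
  rewrite unfold-reverse k (towerWord (suc k) h)
        | act-++ (reverse (towerWord (suc k) h)) (k ∷ []) a | act-++ (reverse (towerWord (suc k) h)) (k ∷ []) b
  with m≤n⇒m<n∨m≡n k<a
... | inj₂ refl
  rewrite swap-suc k | act-fix-below _ k (All-reverse (towerWord-above k h)) | swap-above k b a<b
  = act-reverse-towerWord-≥ (suc k) h b a<b
... | inj₁ 1+k<a rewrite swap-above k a 1+k<a | swap-above k b (<-trans 1+k<a a<b)
  = act-reverse-towerWord-monotone (suc k) h a b 1+k<a a<b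

towersWord : (ℕ → ℕ) → ℕ → ℕ → Word
towersWord h lo zero    = []
towersWord h lo (suc n) = towersWord h (suc lo) n ++ towerWord lo (h lo)

-- the word of the towers lo ≤ k < hi of the height function h, rightmost tower first
towers : (ℕ → ℕ) → ℕ → ℕ → Word
towers h lo hi = towersWord h lo (hi ∸ lo)

InRange : ℕ → ℕ → ℕ → Set
InRange lo hi k = lo ≤ k × k < hi

private
  inRange-suc : ∀ {lo n k} → InRange (suc lo) (suc lo + n) k → InRange lo (lo + suc n) k
  inRange-suc {lo} {n} {k} (1+lo≤k , k<) = <⇒≤ 1+lo≤k , subst (k <_) (sym (+-suc lo n)) k<

  inRange-lo : ∀ lo n → InRange lo (lo + suc n) lo
  inRange-lo lo n = ≤-refl , m<m+n lo z<s

  inRange-count : ∀ {lo hi k} → InRange lo (lo + (hi ∸ lo)) k → InRange lo hi k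
  inRange-count {lo} {hi} {k} (lo≤k , k<) with lo ≤? hi
  ... | yes lo≤hi = lo≤k , subst (k <_) (m+[n∸m]≡n lo≤hi) k<
  ... | no lo≰hi  = ⊥-elim (<⇒≱ (subst (k <_) (trans (cong (lo +_) (m≤n⇒m∸n≡0 (<⇒≤ (≰⇒> lo≰hi)))) (+-identityʳ lo)) k<) lo≤k)

  towersWord-++ : ∀ h lo a b → towersWord h lo (a + b) ≡ towersWord h (lo + a) b ++ towersWord h lo a
  towersWord-++ h lo zero    b rewrite +-identityʳ lo = sym (++-identityʳ _)
  towersWord-++ h lo (suc a) b rewrite towersWord-++ h (suc lo) a b | +-suc lo a =
    ++-assoc (towersWord h (suc (lo + a)) b) _ _

  towersWord-cong : ∀ h h' lo n → (∀ k → InRange lo (lo + n) k → h k ≡ h' k) → towersWord h lo n ≡ towersWord h' lo n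
  towersWord-cong h h' lo zero    eq = refl
  towersWord-cong h h' lo (suc n) eq =
    cong₂ _++_ (towersWord-cong h h' (suc lo) n (λ k r → eq k (inRange-suc r))) (cong (towerWord lo) (eq lo (inRange-lo lo n)))

  towersWord-All : ∀ {P : ℕ → Set} h lo n → (∀ k → InRange lo (lo + n) k → All P (towerWord k (h k))) →
    All P (towersWord h lo n)
  towersWord-All h lo zero    f = []
  towersWord-All h lo (suc n) f = ++⁺ (towersWord-All h (suc lo) n (λ k r → f k (inRange-suc r))) (f lo (inRange-lo lo n))

  towersWord-lower-bound : ∀ h lo n → All (lo ≤_) (towersWord h lo n)
  towersWord-lower-bound h lo n =
    towersWord-All h lo n (λ k (lo≤k , _) → towerWord-All k (h k) (λ j _ → ≤-trans lo≤k (m≤m+n k j)))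

  towersWord-empty : ∀ h lo n → (∀ k → InRange lo (lo + n) k → h k ≡ 0) → towersWord h lo n ≡ []
  towersWord-empty h lo zero    h≡0 = refl
  towersWord-empty h lo (suc n) h≡0 rewrite h≡0 lo (inRange-lo lo n) =
    trans (++-identityʳ _) (towersWord-empty h (suc lo) n (λ k r → h≡0 k (inRange-suc r)))

interval-split : ∀ {lo m hi} → lo ≤ m → m ≤ hi → hi ∸ lo ≡ (m ∸ lo) + (hi ∸ m)
interval-split {lo} {m} {hi} lo≤m m≤hi = trans (cong (_∸ lo) hi≡) (m+n∸m≡n lo _)
  where
  hi≡ : hi ≡ lo + ((m ∸ lo) + (hi ∸ m))
  hi≡ = sym (trans (sym (+-assoc lo _ _)) (trans (cong (_+ (hi ∸ m)) (m+[n∸m]≡n lo≤m)) (m+[n∸m]≡n m≤hi)))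

towers-split : ∀ h {lo} m {hi} → lo ≤ m → m ≤ hi → towers h lo hi ≡ towers h m hi ++ towers h lo m
towers-split h {lo} m {hi} lo≤m m≤hi = begin
  towersWord h lo (hi ∸ lo)                                   ≡⟨ cong (towersWord h lo) (interval-split lo≤m m≤hi) ⟩
  towersWord h lo ((m ∸ lo) + (hi ∸ m))                       ≡⟨ towersWord-++ h lo (m ∸ lo) (hi ∸ m) ⟩
  towersWord h (lo + (m ∸ lo)) (hi ∸ m) ++ towers h lo m      ≡⟨ cong (λ k → towersWord h k (hi ∸ m) ++ towers h lo m) (m+[n∸m]≡n lo≤m) ⟩
  towers h m hi ++ towers h lo m                              ∎
  where open ≡-Reasoning

towers-single : ∀ h t → towers h t (suc t) ≡ towerWord t (h t)
towers-single h t rewrite m+n∸n≡m 1 t = ++-identityˡ _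

towers-cong : ∀ {h h'} lo hi → (∀ k → InRange lo hi k → h k ≡ h' k) → towers h lo hi ≡ towers h' lo hi
towers-cong {h} {h'} lo hi eq = towersWord-cong h h' lo (hi ∸ lo) (λ k r → eq k (inRange-count r))

towers-All : ∀ {P : ℕ → Set} h lo hi → (∀ k → InRange lo hi k → All P (towerWord k (h k))) → All P (towers h lo hi)
towers-All h lo hi f = towersWord-All h lo (hi ∸ lo) (λ k r → f k (inRange-count r))

towers-lower-bound : ∀ h lo hi → All (lo ≤_) (towers h lo hi)
towers-lower-bound h lo hi = towersWord-lower-bound h lo (hi ∸ lo)

towers-empty : ∀ h lo hi → (∀ k → InRange lo hi k → h k ≡ 0) → towers h lo hi ≡ []
towers-empty h lo hi h≡0 = towersWord-empty h lo (hi ∸ lo) (λ k r → h≡0 k (inRange-count r))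

private
  towers-below : ∀ h lo hi → hi < lo → towers h lo hi ≡ []
  towers-below h lo hi hi<lo rewrite m≤n⇒m∸n≡0 (<⇒≤ hi<lo) = refl

  act-reverse-towersWord-≥ : ∀ h lo n a → lo + n ≤ a → lo ≤ act (reverse (towersWord h lo n)) a
  act-reverse-towersWord-≥ h lo zero    a lo+0≤a = ≤-trans (m≤m+n lo 0) lo+0≤a
  act-reverse-towersWord-≥ h lo (suc n) a lo+n<a
    rewrite reverse-++ (towersWord h (suc lo) n) (towerWord lo (h lo))
          | act-++ (reverse (towerWord lo (h lo))) (reverse (towersWord h (suc lo) n)) a
    = act-reverse-towerWord-≥ lo (h lo) _ (act-reverse-towersWord-≥ h (suc lo) n a (subst (_≤ a) (+-suc lo n) lo+n<a))

  act-reverse-towersWord-monotone : ∀ h lo n a b → lo + n ≤ a → a < b →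
    act (reverse (towersWord h lo n)) a < act (reverse (towersWord h lo n)) b
  act-reverse-towersWord-monotone h lo zero    a b _ a<b = a<b
  act-reverse-towersWord-monotone h lo (suc n) a b lo+n<a a<b
    rewrite reverse-++ (towersWord h (suc lo) n) (towerWord lo (h lo))
          | act-++ (reverse (towerWord lo (h lo))) (reverse (towersWord h (suc lo) n)) a
          | act-++ (reverse (towerWord lo (h lo))) (reverse (towersWord h (suc lo) n)) b
    = act-reverse-towerWord-monotone lo (h lo) _ _
        (act-reverse-towersWord-≥ h (suc lo) n a 1+lo+n≤a) (act-reverse-towersWord-monotone h (suc lo) n a b 1+lo+n≤a a<b)
    where 1+lo+n≤a = subst (_≤ a) (+-suc lo n) lo+n<a

  act-towersWord-top : ∀ h lo n → act (towersWord h lo (suc n)) (lo + h lo) ≡ lo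
  act-towersWord-top h lo n = begin
    act (towersWord h (suc lo) n ++ towerWord lo (h lo)) (lo + h lo)    ≡⟨ act-++ (towersWord h (suc lo) n) _ _ ⟩
    act (towersWord h (suc lo) n) (act (towerWord lo (h lo)) (lo + h lo)) ≡⟨ cong (act (towersWord h (suc lo) n)) (act-towerWord-top lo (h lo)) ⟩
    act (towersWord h (suc lo) n) lo                                      ≡⟨ act-fix-below _ lo (towersWord-lower-bound h (suc lo) n) ⟩
    lo                                                                    ∎
    where open ≡-Reasoning

  towersWord-injective-lo : ∀ h h' lo n → act (towersWord h lo (suc n)) ≗ act (towersWord h' lo (suc n)) → h lo ≡ h' lo
  towersWord-injective-lo h h' lo n eq = +-cancelˡ-≡ lo _ _ (act-injective (towersWord h' lo (suc n))
    (trans (sym (eq (lo + h lo))) (trans (act-towersWord-top h lo n) (sym (act-towersWord-top h' lo n)))))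

  towersWord-injective : ∀ h h' lo n → act (towersWord h lo n) ≗ act (towersWord h' lo n) →
    ∀ k → InRange lo (lo + n) k → h k ≡ h' k
  towersWord-injective h h' lo zero    eq k (lo≤k , k<lo+0) = ⊥-elim (<⇒≱ (subst (k <_) (+-identityʳ lo) k<lo+0) lo≤k)
  towersWord-injective h h' lo (suc n) eq k (lo≤k , k<) with m≤n⇒m<n∨m≡n lo≤k
  ... | inj₂ refl = towersWord-injective-lo h h' lo n eq
  ... | inj₁ lo<k = towersWord-injective h h' (suc lo) n rest k (lo<k , subst (k <_) (+-suc lo n) k<)
    where
    split : ∀ g x → act (towersWord g lo (suc n)) x ≡ act (towersWord g (suc lo) n) (act (towerWord lo (g lo)) x)
    split g x = act-++ (towersWord g (suc lo) n) _ x
    rest : act (towersWord h (suc lo) n) ≗ act (towersWord h' (suc lo) n)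
    rest x = begin
      act (towersWord h (suc lo) n) x
        ≡⟨ cong (act (towersWord h (suc lo) n)) (sym (act-reverseʳ (towerWord lo (h lo)) x)) ⟩
      act (towersWord h (suc lo) n) (act (towerWord lo (h lo)) y)
        ≡⟨ trans (sym (split h y)) (trans (eq y) (split h' y)) ⟩
      act (towersWord h' (suc lo) n) (act (towerWord lo (h' lo)) y)
        ≡⟨ cong (λ m → act (towersWord h' (suc lo) n) (act (towerWord lo m) y)) (sym (towersWord-injective-lo h h' lo n eq)) ⟩
      act (towersWord h' (suc lo) n) (act (towerWord lo (h lo)) y)
        ≡⟨ cong (act (towersWord h' (suc lo) n)) (act-reverseʳ (towerWord lo (h lo)) x) ⟩
      act (towersWord h' (suc lo) n) x ∎
      where
      open ≡-Reasoning
      y = act (reverse (towerWord lo (h lo))) x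

towers-injective : ∀ h h' lo hi → act (towers h lo hi) ≗ act (towers h' lo hi) → ∀ k → InRange lo hi k → h k ≡ h' k
towers-injective h h' lo hi eq k (lo≤k , k<hi) =
  towersWord-injective h h' lo (hi ∸ lo) eq k (lo≤k , subst (k <_) (sym (m+[n∸m]≡n (<⇒≤ (≤-<-trans lo≤k k<hi)))) k<hi)

act-reverse-towers-monotone : ∀ h lo hi a b → hi ≤ a → a < b →
  act (reverse (towers h lo hi)) a < act (reverse (towers h lo hi)) b
act-reverse-towers-monotone h lo hi a b hi≤a a<b with lo ≤? hi
... | yes lo≤hi = act-reverse-towersWord-monotone h lo (hi ∸ lo) a b (subst (_≤ a) (sym (m+[n∸m]≡n lo≤hi)) hi≤a) a<b
... | no lo≰hi rewrite towers-below h lo hi (≰⇒> lo≰hi) = a<b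

act-towers-split : ∀ h {lo} m {hi} → lo ≤ m → m ≤ hi → ∀ x → act (towers h lo hi) x ≡ act (towers h m hi) (act (towers h lo m) x)
act-towers-split h m lo≤m m≤hi x = trans (cong (λ w → act w x) (towers-split h m lo≤m m≤hi)) (act-++ (towers h m _) _ x)

act-towers-at : ∀ h {lo} t {hi} → lo ≤ t → t < hi → ∀ x →
  act (towers h lo hi) x ≡ act (towers h (suc t) hi) (act (towerWord t (h t)) (act (towers h lo t) x))
act-towers-at h {lo} t {hi} lo≤t t<hi x = begin
  act (towers h lo hi) x                                      ≡⟨ act-towers-split h t lo≤t (<⇒≤ t<hi) x ⟩
  act (towers h t hi) (act (towers h lo t) x)                 ≡⟨ act-towers-split h (suc t) (n≤1+n t) t<hi _ ⟩
  act (towers h (suc t) hi) (act (towers h t (suc t)) (act (towers h lo t) x))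
    ≡⟨ cong (λ w → act (towers h (suc t) hi) (act w (act (towers h lo t) x))) (towers-single h t) ⟩
  act (towers h (suc t) hi) (act (towerWord t (h t)) (act (towers h lo t) x)) ∎
  where open ≡-Reasoning

cellSum : Cell → ℕ
cellSum (i , j) = i + j

towerWord-applyUpTo : ∀ f k h → (∀ j → f j ≡ k + j) → applyUpTo f h ≡ towerWord k h
towerWord-applyUpTo f k zero    f≡ = refl
towerWord-applyUpTo f k (suc h) f≡ =
  cong₂ _∷_ (trans (f≡ 0) (+-identityʳ k)) (towerWord-applyUpTo (λ j → f (suc j)) (suc k) h (λ j → trans (f≡ (suc j)) (+-suc k j)))

towerCells-sums : ∀ k h → map cellSum (towerCells k h) ≡ towerWord k h
towerCells-sums k h = begin
  map cellSum (map (k ,_) (upTo h)) ≡⟨ sym (map-∘ (upTo h)) ⟩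
  map (k +_) (upTo h)              ≡⟨ map-upTo (k +_) h ⟩
  applyUpTo (k +_) h               ≡⟨ towerWord-applyUpTo (k +_) k h (λ _ → refl) ⟩
  towerWord k h                    ∎
  where open ≡-Reasoning

labelling-sums : ∀ k T g n → (∀ i → g (k + i) ≡ heightAt T i) → length T ≤ n → map cellSum (labellingFrom k T) ≡ towersWord g k n
labelling-sums k []      g n g≡ _ = sym (towersWord-empty g k n (λ i (k≤i , _) → trans (cong g (sym (m+[n∸m]≡n k≤i))) (g≡ (i ∸ k))))
labelling-sums k (h ∷ T) g (suc n) g≡ (s≤s |T|≤n) = begin
  map cellSum (labellingFrom (suc k) T ++ towerCells k h)
    ≡⟨ map-++ cellSum (labellingFrom (suc k) T) (towerCells k h) ⟩
  map cellSum (labellingFrom (suc k) T) ++ map cellSum (towerCells k h)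
    ≡⟨ cong₂ _++_ (labelling-sums (suc k) T g n (λ i → trans (cong g (sym (+-suc k i))) (g≡ (suc i))) |T|≤n) (towerCells-sums k h) ⟩
  towersWord g (suc k) n ++ towerWord k h
    ≡⟨ cong (λ m → towersWord g (suc k) n ++ towerWord k m) (sym (trans (cong g (sym (+-identityʳ k))) (g≡ 0))) ⟩
  towersWord g k (suc n) ∎
  where open ≡-Reasoning

naturalWord-towers : ∀ T hi → length T < hi → naturalWord T ≡ towers (height T) 1 hi
naturalWord-towers T (suc n) (s≤s |T|≤n) = labelling-sums 1 T (height T) n (λ _ → refl) |T|≤n

-- Sliding

heightAt-beyond : ∀ T i → length T ≤ i → heightAt T i ≡ 0
heightAt-beyond []      i       _          = refl
heightAt-beyond (h ∷ T) (suc i) (s≤s |T|≤i) = heightAt-beyond T i |T|≤i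

height-beyond : ∀ T i → length T < i → height T i ≡ 0
height-beyond T (suc i) (s≤s |T|≤i) = heightAt-beyond T i |T|≤i

∈ᵀ⇒≤length : ∀ T i j → (i , j) ∈ᵀ T → i ≤ length T
∈ᵀ⇒≤length T i j j<h with i ≤? length T
... | yes i≤|T| = i≤|T|
... | no i≰|T| = ⊥-elim (n≮0 (subst (j <_) (height-beyond T i (≰⇒> i≰|T|)) j<h))

private
  heightAt-growAt-here : ∀ T k → heightAt (growAt T k) k ≡ suc (heightAt T k)
  heightAt-growAt-here []      zero    = refl
  heightAt-growAt-here []      (suc k) = heightAt-growAt-here [] k
  heightAt-growAt-here (h ∷ T) zero    = refl
  heightAt-growAt-here (h ∷ T) (suc k) = heightAt-growAt-here T k

  heightAt-growAt-other : ∀ T k j → j ≢ k → heightAt (growAt T k) j ≡ heightAt T j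
  heightAt-growAt-other []      zero    zero    j≢k = ⊥-elim (j≢k refl)
  heightAt-growAt-other []      zero    (suc j) j≢k = refl
  heightAt-growAt-other []      (suc k) zero    j≢k = refl
  heightAt-growAt-other []      (suc k) (suc j) j≢k = heightAt-growAt-other [] k j (j≢k ∘ cong suc)
  heightAt-growAt-other (h ∷ T) zero    zero    j≢k = ⊥-elim (j≢k refl)
  heightAt-growAt-other (h ∷ T) zero    (suc j) j≢k = refl
  heightAt-growAt-other (h ∷ T) (suc k) zero    j≢k = refl
  heightAt-growAt-other (h ∷ T) (suc k) (suc j) j≢k = heightAt-growAt-other T k j (j≢k ∘ cong suc)

  length-growAt-≥ : ∀ T k → length T ≤ length (growAt T k)
  length-growAt-≥ []      k       = z≤n
  length-growAt-≥ (h ∷ T) zero    = ≤-refl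
  length-growAt-≥ (h ∷ T) (suc k) = s≤s (length-growAt-≥ T k)

  length-growAt-> : ∀ T k → k < length (growAt T k)
  length-growAt-> []      zero    = ≤-refl
  length-growAt-> []      (suc k) = s≤s (length-growAt-> [] k)
  length-growAt-> (h ∷ T) zero    = s≤s z≤n
  length-growAt-> (h ∷ T) (suc k) = s≤s (length-growAt-> T k)

  sum-growAt : ∀ T k → sum (growAt T k) ≡ suc (sum T)
  sum-growAt []      zero    = refl
  sum-growAt []      (suc k) = sum-growAt [] k
  sum-growAt (h ∷ T) zero    = refl
  sum-growAt (h ∷ T) (suc k) = trans (cong (h +_) (sum-growAt T k)) (+-suc h (sum T))

height-grow-here : ∀ T t → 1 ≤ t → height (grow T t) t ≡ suc (height T t)
height-grow-here T (suc k) _ = heightAt-growAt-here T k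

height-grow-other : ∀ T t k → 1 ≤ t → k ≢ t → height (grow T t) k ≡ height T k
height-grow-other T (suc t) zero    _ _   = refl
height-grow-other T (suc t) (suc k) _ k≢t = heightAt-growAt-other T t k (k≢t ∘ cong suc)

length-grow-≥ : ∀ T t → length T ≤ length (grow T t)
length-grow-≥ T zero    = ≤-refl
length-grow-≥ T (suc t) = length-growAt-≥ T t

length-grow-≥-index : ∀ T t → t ≤ length (grow T t)
length-grow-≥-index T zero    = z≤n
length-grow-≥-index T (suc t) = length-growAt-> T t

sum-grow : ∀ T t → 1 ≤ t → sum (grow T t) ≡ suc (sum T)
sum-grow T (suc t) _ = sum-growAt T t

DiagonalFreeBetween : Diagram → ℕ → ℕ → ℕ → Set
DiagonalFreeBetween T γ m t = ∀ k j → m ≤ k → k < t → suc (k + j) ≡ γ → ¬ ((k , j) ∈ᵀ T)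

towerWord-far : ∀ k h γ → k < γ → (∀ j → suc (k + j) ≡ γ → ¬ (j < h)) → All (Far γ) (towerWord k h)
towerWord-far k h γ k<γ off = towerWord-All k h (λ j j<h → inj₁ (begin-strict
  suc (k + j)        <⟨ s<s (+-monoʳ-< k j<h) ⟩
  suc (k + h)        ≤⟨ +-monoʳ-≤ 1 (+-monoʳ-≤ k h≤d) ⟩
  suc (k + d)        ≡⟨ m+[n∸m]≡n k<γ ⟩
  γ                  ∎))
  where
  open ≤-Reasoning
  d = γ ∸ suc k
  h≤d : h ≤ d
  h≤d = ≮⇒≥ (off d (m+[n∸m]≡n k<γ))

towers-far : ∀ T γ m t → DiagonalFreeBetween T γ m t → t ≤ γ → All (Far γ) (towers (height T) m t)
towers-far T γ m t free t≤γ =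
  towers-All (height T) m t (λ k (m≤k , k<t) → towerWord-far k (height T k) γ (<-≤-trans k<t t≤γ) (λ j → free k j m≤k k<t))

towers-self : ∀ h lo → towers h lo lo ≡ []
towers-self h lo rewrite n∸n≡0 lo = refl

act-towers-around : ∀ h {lo} m t {hi} → lo ≤ m → m ≤ t → t < hi → ∀ x →
  act (towers h lo hi) x ≡ act (towers h (suc t) hi) (act (towerWord t (h t)) (act (towers h m t) (act (towers h lo m) x)))
act-towers-around h m t lo≤m m≤t t<hi x =
  trans (act-towers-split h m lo≤m (≤-trans m≤t (<⇒≤ t<hi)) x) (act-towers-at h t m≤t t<hi _)

act-towers-up-to : ∀ h {lo} m t → lo ≤ m → m ≤ t → ∀ x →
  act (towers h lo (suc t)) x ≡ act (towerWord t (h t)) (act (towers h m t) (act (towers h lo m) x))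
act-towers-up-to h m t lo≤m m≤t x
  rewrite act-towers-around h m t lo≤m m≤t ≤-refl x | towers-self h (suc t) = refl

act-towers-insert-swap : ∀ h γ m t {hi} → m ≤ t → t < hi → All (Far γ) (towers h m t) → ∀ y →
  act (towers h (suc t) hi) (act (towerWord t (h t)) (swap γ (act (towers h m t) y))) ≡ act (towers h m hi) (swap γ y)
act-towers-insert-swap h γ m t {hi} m≤t t<hi far y = begin
  act (towers h (suc t) hi) (act (towerWord t (h t)) (swap γ (act (towers h m t) y)))
    ≡⟨ cong (λ z → act (towers h (suc t) hi) (act (towerWord t (h t)) z)) (sym (act-swap-comm (towers h m t) γ y far)) ⟩
  act (towers h (suc t) hi) (act (towerWord t (h t)) (act (towers h m t) (swap γ y)))
    ≡⟨ sym (act-towers-at h t m≤t t<hi (swap γ y)) ⟩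
  act (towers h m hi) (swap γ y) ∎
  where open ≡-Reasoning

towers-grow-other : ∀ T t lo hi → 1 ≤ t → (∀ k → InRange lo hi k → k ≢ t) →
  towers (height (grow T t)) lo hi ≡ towers (height T) lo hi
towers-grow-other T t lo hi 1≤t off = towers-cong lo hi (λ k r → height-grow-other T t k 1≤t (off k r))

act-towers-grow : ∀ T γ m t {hi} → 1 ≤ m → m ≤ t → t < hi → t + height T t ≡ γ →
  All (Far γ) (towers (height T) m t) → ∀ x →
  act (towers (height (grow T t)) 1 hi) x ≡ act (towers (height T) m hi) (swap γ (act (towers (height T) 1 m) x))
act-towers-grow T γ m t {hi} 1≤m m≤t t<hi top≡γ far x = begin
  act (towers h₁ 1 hi) x
    ≡⟨ act-towers-around h₁ m t 1≤m m≤t t<hi x ⟩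
  act (towers h₁ (suc t) hi) (act (towerWord t (h₁ t)) (act (towers h₁ m t) (act (towers h₁ 1 m) x)))
    ≡⟨ cong₂ (λ w v → act w (act (towerWord t (h₁ t)) (act v (act (towers h₁ 1 m) x))))
         (towers-grow-other T t (suc t) hi 1≤t (λ k (t<k , _) → >⇒≢ t<k))
         (towers-grow-other T t m t 1≤t (λ k (_ , k<t) → <⇒≢ k<t)) ⟩
  act (towers h (suc t) hi) (act (towerWord t (h₁ t)) (B (act (towers h₁ 1 m) x)))
    ≡⟨ cong₂ (λ v n → act (towers h (suc t) hi) (act (towerWord t n) (B (act v x))))
         (towers-grow-other T t 1 m 1≤t (λ k (_ , k<m) → <⇒≢ (<-≤-trans k<m m≤t)))
         (height-grow-here T t 1≤t) ⟩
  act (towers h (suc t) hi) (act (towerWord t (suc (h t))) (B (Y x)))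
    ≡⟨ cong (λ w → act (towers h (suc t) hi) (act w (B (Y x)))) (towerWord-snoc t (h t)) ⟩
  act (towers h (suc t) hi) (act (towerWord t (h t) ++ t + h t ∷ []) (B (Y x)))
    ≡⟨ cong (act (towers h (suc t) hi)) (act-++ (towerWord t (h t)) (t + h t ∷ []) (B (Y x))) ⟩
  act (towers h (suc t) hi) (act (towerWord t (h t)) (swap (t + h t) (B (Y x))))
    ≡⟨ cong (λ g → act (towers h (suc t) hi) (act (towerWord t (h t)) (swap g (B (Y x))))) top≡γ ⟩
  act (towers h (suc t) hi) (act (towerWord t (h t)) (swap γ (B (Y x))))
    ≡⟨ act-towers-insert-swap h γ m t m≤t t<hi far (Y x) ⟩
  act (towers h m hi) (swap γ (Y x)) ∎
  where
  open ≡-Reasoning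
  h  = height T
  h₁ = height (grow T t)
  B  = act (towers h m t)
  Y  = act (towers h 1 m)
  1≤t = ≤-trans 1≤m m≤t

act-towers-braid : ∀ h γ m t {hi} → 1 ≤ m → m ≤ t → t ≤ γ → t < hi → 2 + γ ≤ t + h t →
  All (Far γ) (towers h m t) → ∀ x →
  act (towers h (suc t) hi) (swap (suc γ) (act (towers h 1 (suc t)) x)) ≡ act (towers h m hi) (swap γ (act (towers h 1 m) x))
act-towers-braid h γ m t {hi} 1≤m m≤t t≤γ t<hi γ+2≤ far x = begin
  act (towers h (suc t) hi) (swap (suc γ) (act (towers h 1 (suc t)) x))
    ≡⟨ cong (λ z → act (towers h (suc t) hi) (swap (suc γ) z)) (act-towers-up-to h m t 1≤m m≤t x) ⟩
  act (towers h (suc t) hi) (swap (suc γ) (act (towerWord t (h t)) (B (Y x))))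
    ≡⟨ cong (act (towers h (suc t) hi)) (sym (act-towerWord-braid t (h t) γ (B (Y x)) t≤γ γ+2≤)) ⟩
  act (towers h (suc t) hi) (act (towerWord t (h t)) (swap γ (B (Y x))))
    ≡⟨ act-towers-insert-swap h γ m t m≤t t<hi far (Y x) ⟩
  act (towers h m hi) (swap γ (Y x)) ∎
  where
  open ≡-Reasoning
  B = act (towers h m t)
  Y = act (towers h 1 m)

slide-length : ∀ {T γ m T₁} → Slide T γ m T₁ → length T ≤ length T₁
slide-length {T} {γ} (s1a _ _)           = length-grow-≥ T γ
slide-length (s1c _ _ _ s)               = slide-length s
slide-length {T} (s2a {i = i} _ _)       = length-grow-≥ T i
slide-length (s2c _ _ _ s)               = slide-length s

private
  diagonal-index : ∀ {i j γ} → suc (i + j) ≡ γ → i ≤ γ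
  diagonal-index {i} {j} eq = subst (i ≤_) eq (≤-trans (m≤m+n i j) (n≤1+n _))

  above-next-diagonal : ∀ {i j γ h} → suc (i + j) ≡ γ → 3 + j ≤ h → 2 + γ ≤ i + h
  above-next-diagonal {i} {j} {γ} {h} eq 3+j≤h = begin
    2 + γ               ≡⟨ cong (2 +_) (sym eq) ⟩
    3 + (i + j)         ≡⟨ sym (trans (+-suc i (2 + j)) (cong suc (trans (+-suc i (1 + j)) (cong suc (+-suc i j))))) ⟩
    i + (3 + j)         ≤⟨ +-monoʳ-≤ i 3+j≤h ⟩
    i + h               ∎
    where open ≤-Reasoning

slide-towers : ∀ {T γ m T₁} → Slide T γ m T₁ → 1 ≤ m → m ≤ γ → ∀ hi → length T₁ < hi → ∀ x →
  act (towers (height T₁) 1 hi) x ≡ act (towers (height T) m hi) (swap γ (act (towers (height T) 1 m) x))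
slide-towers {T} {γ} {m} (s1a free γ∉T) 1≤m m≤γ hi |T₁|<hi =
  act-towers-grow T γ m γ 1≤m m≤γ (≤-<-trans (length-grow-≥-index T γ) |T₁|<hi) top
    (towers-far T γ m γ (λ k j m≤k _ → free k j m≤k) ≤-refl)
  where
  top : γ + height T γ ≡ γ
  top = trans (cong (γ +_) (n≤0⇒n≡0 (≮⇒≥ γ∉T))) (+-identityʳ γ)
slide-towers {T} {γ} {m} (s2a {i = i} {j = j} (m≤i , diag , j∈T , first) j+1∉T) 1≤m m≤γ hi |T₁|<hi =
  act-towers-grow T γ m i 1≤m m≤i (≤-<-trans (length-grow-≥-index T i) |T₁|<hi) top
    (towers-far T γ m i first (diagonal-index diag))
  where
  top : i + height T i ≡ γ
  top = trans (cong (i +_) (≤-antisym (≮⇒≥ j+1∉T) j∈T)) (trans (+-suc i j) diag)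
slide-towers {T} {γ} {m} (s1c free _ γ1∈T s) 1≤m m≤γ hi |T₁|<hi x =
  trans (slide-towers s (s≤s z≤n) ≤-refl hi |T₁|<hi x)
        (act-towers-braid (height T) γ m γ 1≤m m≤γ ≤-refl γ<hi (subst (_≤ γ + height T γ) (+-comm γ 2) (+-monoʳ-≤ γ γ1∈T))
          (towers-far T γ m γ (λ k j m≤k _ → free k j m≤k) ≤-refl) x)
  where
  γ<hi = ≤-<-trans (∈ᵀ⇒≤length T γ 1 γ1∈T) (≤-<-trans (slide-length s) |T₁|<hi)
slide-towers {T} {γ} {m} (s2c {i = i} {j = j} (m≤i , diag , j∈T , first) _ j+2∈T s) 1≤m m≤γ hi |T₁|<hi x =
  trans (slide-towers s (s≤s z≤n) (s≤s (diagonal-index diag)) hi |T₁|<hi x)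
        (act-towers-braid (height T) γ m i 1≤m m≤i (diagonal-index diag) i<hi (above-next-diagonal diag j+2∈T)
          (towers-far T γ m i first (diagonal-index diag)) x)
  where
  i<hi = ≤-<-trans (∈ᵀ⇒≤length T i j j∈T) (≤-<-trans (slide-length s) |T₁|<hi)

slide-naturalWord : ∀ {T a T₁} → Slide T a 1 T₁ → 1 ≤ a → ∀ x → act (naturalWord T₁) x ≡ act (naturalWord T) (swap a x)
slide-naturalWord {T} {a} {T₁} s 1≤a x = begin
  act (naturalWord T₁) x                       ≡⟨ cong (λ w → act w x) (naturalWord-towers T₁ hi ≤-refl) ⟩
  act (towers (height T₁) 1 hi) x              ≡⟨ slide-towers s ≤-refl 1≤a hi ≤-refl x ⟩
  act (towers (height T) 1 hi) (swap a x)      ≡⟨ cong (λ w → act w (swap a x)) (sym (naturalWord-towers T hi (s≤s (slide-length s)))) ⟩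
  act (naturalWord T) (swap a x)               ∎
  where
  open ≡-Reasoning
  hi = suc (length T₁)

slides-naturalWord : ∀ {T₀ w T₂} → SlidesFrom T₀ w T₂ → PositiveLetters w →
  ∀ x → act (naturalWord T₂) x ≡ act (naturalWord T₀) (act w x)
slides-naturalWord done                    []          x = refl
slides-naturalWord (step {w = w} s ss) (1≤a ∷ pos) x =
  trans (slides-naturalWord ss pos x) (slide-naturalWord s 1≤a (act w x))

slide-sum : ∀ {T γ m T₁} → Slide T γ m T₁ → 1 ≤ m → m ≤ γ → sum T₁ ≡ suc (sum T)
slide-sum {T} {γ} (s1a _ _)                     1≤m m≤γ = sum-grow T γ (≤-trans 1≤m m≤γ)
slide-sum {T} (s2a {i = i} (m≤i , _) _)         1≤m _   = sum-grow T i (≤-trans 1≤m m≤i)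
slide-sum (s1c _ _ _ s)                         _   _   = slide-sum s (s≤s z≤n) ≤-refl
slide-sum (s2c (_ , diag , _) _ _ s)            _   _   = slide-sum s (s≤s z≤n) (s≤s (diagonal-index diag))

slides-sum : ∀ {T₀ w T₂} → SlidesFrom T₀ w T₂ → PositiveLetters w → sum T₂ ≡ length w + sum T₀
slides-sum done [] = refl
slides-sum {T₀} (step {w = w} s ss) (1≤a ∷ pos) =
  trans (slides-sum ss pos) (trans (cong (length w +_) (slide-sum s ≤-refl 1≤a)) (+-suc (length w) (sum T₀)))

naturalWord-injective : ∀ T T' → (∀ x → act (naturalWord T) x ≡ act (naturalWord T') x) → ∀ k → height T k ≡ height T' k
naturalWord-injective T T' eq zero    = refl
naturalWord-injective T T' eq (suc k) with suc k <? hi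
  where hi = suc (length T + length T')
... | yes k<hi = towers-injective (height T) (height T') 1 hi eq' (suc k) (s≤s z≤n , k<hi)
  where
  hi = suc (length T + length T')
  eq' : ∀ x → act (towers (height T) 1 hi) x ≡ act (towers (height T') 1 hi) x
  eq' x = trans (cong (λ w → act w x) (sym (naturalWord-towers T hi (s≤s (m≤m+n _ _)))))
                (trans (eq x) (cong (λ w → act w x) (naturalWord-towers T' hi (s≤s (m≤n+m _ _)))))
... | no k≮hi = trans (height-beyond T (suc k) (s≤s (≤-trans (m≤m+n _ _) k≥))) (sym (height-beyond T' (suc k) (s≤s (≤-trans (m≤n+m _ _) k≥))))
  where k≥ = ≤-pred (≮⇒≥ k≮hi)

-- Empty and merged towers

private
  act-naturalWord-from : ∀ V t → 1 ≤ t → (∀ k → InRange 1 t k → height V k ≡ 0) → ∀ x →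
    act (naturalWord V) x ≡ act (towers (height V) (suc t) (suc (length V + t))) (act (towerWord t (height V t)) x)
  act-naturalWord-from V t 1≤t empty x = begin
    act (naturalWord V) x
      ≡⟨ cong (λ w → act w x) (naturalWord-towers V hi (s≤s (m≤m+n _ _))) ⟩
    act (towers (height V) 1 hi) x
      ≡⟨ act-towers-at (height V) t 1≤t (s≤s (m≤n+m t _)) x ⟩
    act (towers (height V) (suc t) hi) (act (towerWord t (height V t)) (act (towers (height V) 1 t) x))
      ≡⟨ cong (λ w → act (towers (height V) (suc t) hi) (act (towerWord t (height V t)) (act w x))) (towers-empty (height V) 1 t empty) ⟩
    act (towers (height V) (suc t) hi) (act (towerWord t (height V t)) x) ∎
    where
    open ≡-Reasoning
    hi = suc (length V + t)

act-naturalWord-leftmost-top : ∀ V t → 1 ≤ t → (∀ k → InRange 1 t k → height V k ≡ 0) →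
  act (naturalWord V) (t + height V t) ≡ t
act-naturalWord-leftmost-top V t 1≤t empty =
  trans (act-naturalWord-from V t 1≤t empty _)
        (trans (cong (act (towers (height V) (suc t) hi)) (act-towerWord-top t (height V t)))
               (act-fix-below _ t (towers-lower-bound (height V) (suc t) hi)))
  where hi = suc (length V + t)

act-naturalWord-above-leftmost-top : ∀ V t → 1 ≤ t → (∀ k → InRange 1 t k → height V k ≡ 0) →
  ∀ j → t + height V t < j → t < act (naturalWord V) j
act-naturalWord-above-leftmost-top V t 1≤t empty j top<j =
  subst (t <_) (sym (trans (act-naturalWord-from V t 1≤t empty j)
                           (cong (act (towers (height V) (suc t) hi)) (act-towerWord-fix-above t (height V t) j top<j))))
    (act-preserves-lower-bound _ t j (towers-lower-bound (height V) (suc t) hi) (≤-<-trans (m≤m+n t _) top<j))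
  where hi = suc (length V + t)

nonempty-tower-inversion : ∀ V e → 1 ≤ e → 1 ≤ height V e →
  Σ ℕ λ x → Σ ℕ λ y → y < x × act (naturalWord V) x ≡ e × e < act (naturalWord V) y
nonempty-tower-inversion V e 1≤e 1≤h = x₀ , y₀ , y₀<x₀ , πx₀ , e<πy₀
  where
  h = height V
  hi = suc (length V)
  X = act (towers h (suc e) hi)
  C = act (towerWord e (h e))
  Y⁻¹ = act (reverse (towers h 1 e))
  π≡ : ∀ x → act (naturalWord V) x ≡ X (C (act (towers h 1 e) x))
  π≡ x = trans (cong (λ w → act w x) (naturalWord-towers V hi ≤-refl))
               (act-towers-at h e 1≤e (s≤s (∈ᵀ⇒≤length V e 0 1≤h)) x)
  X-above-e : All (e <_) (towers h (suc e) hi)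
  X-above-e = towers-lower-bound h (suc e) hi
  x₀ = Y⁻¹ (e + h e)
  y₀ = Y⁻¹ e
  πx₀ : act (naturalWord V) x₀ ≡ e
  πx₀ = trans (π≡ x₀) (trans (cong (λ z → X (C z)) (act-reverseʳ (towers h 1 e) (e + h e)))
          (trans (cong X (act-towerWord-top e (h e))) (act-fix-below _ e X-above-e)))
  e<πy₀ : e < act (naturalWord V) y₀
  e<πy₀ = subst (e <_) (sym (trans (π≡ y₀) (cong (λ z → X (C z)) (act-reverseʳ (towers h 1 e) e))))
            (subst (λ z → e < X z) (sym (act-towerWord-bottom e (h e) 1≤h)) (act-preserves-lower-bound _ e (suc e) X-above-e ≤-refl))
  y₀<x₀ : y₀ < x₀
  y₀<x₀ = act-reverse-towers-monotone h 1 e e (e + h e) ≤-refl (m<m+n e 1≤h)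

shiftTower : ℕ → (ℕ → ℕ) → ℕ → ℕ
shiftTower e g k with k ≟ e | k ≟ suc e
... | yes _ | _     = suc (g (suc e))
... | no _  | yes _ = 0
... | no _  | no _  = g k

shiftTower-here : ∀ e g → shiftTower e g e ≡ suc (g (suc e))
shiftTower-here e g with e ≟ e
... | yes _  = refl
... | no e≢e = ⊥-elim (e≢e refl)

shiftTower-next : ∀ e g → shiftTower e g (suc e) ≡ 0
shiftTower-next e g with suc e ≟ e | suc e ≟ suc e
... | yes 1+e≡e | _ = ⊥-elim (1+n≢n 1+e≡e)
... | no _ | yes _  = refl
... | no _ | no ne  = ⊥-elim (ne refl)

shiftTower-other : ∀ e g k → k ≢ e → k ≢ suc e → shiftTower e g k ≡ g k
shiftTower-other e g k k≢e k≢1+e with k ≟ e | k ≟ suc e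
... | yes k≡e | _        = ⊥-elim (k≢e k≡e)
... | no _    | yes k≡1+e = ⊥-elim (k≢1+e k≡1+e)
... | no _    | no _      = refl

private
  act-towers-pair : ∀ h e hi → 1 ≤ e → suc e < hi → ∀ x → act (towers h 1 hi) x ≡
    act (towers h (2 + e) hi) (act (towerWord (suc e) (h (suc e))) (act (towerWord e (h e)) (act (towers h 1 e) x)))
  act-towers-pair h e hi 1≤e 1+e<hi x
    rewrite act-towers-around h e (suc e) 1≤e (n≤1+n e) 1+e<hi x | towers-single h e = refl

act-towers-shiftTower : ∀ g e hi → 1 ≤ e → suc e < hi → g e ≡ 0 → ∀ x →
  act (towers (shiftTower e g) 1 hi) x ≡ swap e (act (towers g 1 hi) x)
act-towers-shiftTower g e hi 1≤e 1+e<hi ge≡0 x = begin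
  act (towers g' 1 hi) x
    ≡⟨ act-towers-pair g' e hi 1≤e 1+e<hi x ⟩
  act (towers g' (2 + e) hi) (act (towerWord (suc e) (g' (suc e))) (act (towerWord e (g' e)) (act (towers g' 1 e) x)))
    ≡⟨ cong₂ (λ w v → act w (act (towerWord (suc e) (g' (suc e))) (act (towerWord e (g' e)) (act v x))))
         (towers-cong (2 + e) hi (λ k (2+e≤k , _) → shiftTower-other e g k (>⇒≢ (<-trans (n<1+n e) 2+e≤k)) (>⇒≢ 2+e≤k)))
         (towers-cong 1 e (λ k (_ , k<e) → shiftTower-other e g k (<⇒≢ k<e) (<⇒≢ (m<n⇒m<1+n k<e)))) ⟩
  X (act (towerWord (suc e) (g' (suc e))) (act (towerWord e (g' e)) (Y x)))
    ≡⟨ cong₂ (λ n₁ n₂ → X (act (towerWord (suc e) n₁) (act (towerWord e n₂) (Y x)))) (shiftTower-next e g) (shiftTower-here e g) ⟩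
  -- towerWord e (suc h) is e ∷ towerWord (suc e) h, so the merged tower acts as swap e after tower e + 1
  X (swap e (C (Y x)))
    ≡⟨ act-swap-comm (towers g (2 + e) hi) e (C (Y x)) (All.map inj₂ (towers-lower-bound g (2 + e) hi)) ⟩
  swap e (X (C (Y x)))
    ≡⟨ cong (λ n → swap e (X (C (act (towerWord e n) (Y x))))) (sym ge≡0) ⟩
  swap e (X (C (act (towerWord e (g e)) (Y x))))
    ≡⟨ cong (swap e) (sym (act-towers-pair g e hi 1≤e 1+e<hi x)) ⟩
  swap e (act (towers g 1 hi) x) ∎
  where
  open ≡-Reasoning
  g' = shiftTower e g
  X = act (towers g (2 + e) hi)
  C = act (towerWord (suc e) (g (suc e)))
  Y = act (towers g 1 e)

height-shiftTower : ∀ U U' e → 1 ≤ e → height U' e ≡ 0 →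
  (∀ x → act (naturalWord U) x ≡ swap e (act (naturalWord U') x)) → ∀ k → height U k ≡ shiftTower e (height U') k
height-shiftTower U U' e 1≤e U'e≡0 eq zero = sym (shiftTower-other e (height U') 0 (<⇒≢ 1≤e) (λ ()))
height-shiftTower U U' e 1≤e U'e≡0 eq (suc k) with suc k <? hi
  where hi = 2 + (length U + length U' + e)
... | yes k<hi = towers-injective (height U) (shiftTower e (height U')) 1 hi eq' (suc k) (s≤s z≤n , k<hi)
  where
  hi = 2 + (length U + length U' + e)
  eq' : ∀ x → act (towers (height U) 1 hi) x ≡ act (towers (shiftTower e (height U')) 1 hi) x
  eq' x = begin
    act (towers (height U) 1 hi) x     ≡⟨ cong (λ w → act w x) (sym (naturalWord-towers U hi (s≤s (≤-trans (m≤m+n _ _) (≤-trans (m≤m+n _ e) (n≤1+n _)))))) ⟩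
    act (naturalWord U) x              ≡⟨ eq x ⟩
    swap e (act (naturalWord U') x)    ≡⟨ cong (λ w → swap e (act w x)) (naturalWord-towers U' hi (s≤s (≤-trans (m≤n+m _ _) (≤-trans (m≤m+n _ e) (n≤1+n _))))) ⟩
    swap e (act (towers (height U') 1 hi) x)
                                       ≡⟨ sym (act-towers-shiftTower (height U') e hi 1≤e (s≤s (s≤s (m≤n+m e _))) U'e≡0 x) ⟩
    act (towers (shiftTower e (height U')) 1 hi) x ∎
    where open ≡-Reasoning
... | no k≮hi = trans (height-beyond U (suc k) (≤-<-trans (m≤m+n _ _) big))
                  (sym (trans (shiftTower-other e (height U') (suc k) (>⇒≢ (<-trans (n<1+n e) 1+e<k)) (>⇒≢ 1+e<k))
                              (height-beyond U' (suc k) (≤-<-trans (m≤n+m _ _) big))))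
  where
  sum<k : length U + length U' + e < suc k
  sum<k = ≤-trans (n≤1+n _) (≮⇒≥ k≮hi)
  big : length U + length U' < suc k
  big = ≤-<-trans (m≤m+n _ e) sum<k
  1+e<k : suc e < suc k
  1+e<k = ≤-trans (s≤s (s≤s (m≤n+m e _))) (≮⇒≥ k≮hi)

shiftTower-cells : ∀ (g g' : ℕ → ℕ) e → g' e ≡ 0 → (∀ k → g k ≡ shiftTower e g' k) → ∀ a b →
  (b < g' a) ⇔ (((b < g a) × (a ≢ e)) ⊎ ((a ≡ suc e) × (suc b < g e)))
shiftTower-cells g g' e g'e≡0 g≡ a b with a ≟ e
... | yes refl = mk⇔ (λ b<0 → ⊥-elim (n≮0 (subst (b <_) g'e≡0 b<0)))
                     (λ { (inj₁ (_ , a≢a)) → ⊥-elim (a≢a refl) ; (inj₂ (a≡1+a , _)) → ⊥-elim (1+n≢n (sym a≡1+a)) })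
... | no a≢e with a ≟ suc e
...   | yes refl = mk⇔ (λ b< → inj₂ (refl , subst (suc b <_) (sym ge) (s≤s b<)))
                       (λ { (inj₁ (b< , _)) → ⊥-elim (n≮0 (subst (b <_) (trans (g≡ (suc e)) (shiftTower-next e g')) b<))
                          ; (inj₂ (_ , 1+b<)) → ≤-pred (subst (suc b <_) ge 1+b<) })
  where
  ge : g e ≡ suc (g' (suc e))
  ge = trans (g≡ e) (shiftTower-here e g')
...   | no a≢1+e = mk⇔ (λ b< → inj₁ (subst (b <_) (sym ga) b< , a≢e))
                       (λ { (inj₁ (b< , _)) → subst (b <_) ga b< ; (inj₂ (a≡1+e , _)) → ⊥-elim (a≢1+e a≡1+e) })
  where
  ga : g a ≡ g' a
  ga = trans (g≡ a) (shiftTower-other e g' a a≢e a≢1+e)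

-- The last cell

-- deletes the cell carrying the largest natural label: the top of the leftmost nonempty tower
removeLast : Diagram → Diagram
removeLast []          = []
removeLast (zero ∷ T)  = zero ∷ removeLast T
removeLast (suc h ∷ T) = h ∷ T

record LeftmostTower (k : ℕ) (T : Diagram) : Set where
  field
    gap top : ℕ
    labelling-removeLast : labellingFrom k T ≡ labellingFrom k (removeLast T) ++ (k + gap , top) ∷ []
    height-leftmost : heightAt T gap ≡ suc top
    height-removeLast-leftmost : heightAt (removeLast T) gap ≡ top
    height-removeLast-other : ∀ i → i ≢ gap → heightAt (removeLast T) i ≡ heightAt T i
    height-before-leftmost : ∀ i → i < gap → heightAt T i ≡ 0

towerCells-snoc : ∀ k h → towerCells k (suc h) ≡ towerCells k h ++ (k , h) ∷ []
towerCells-snoc k h = trans (cong (map (k ,_)) (sym (upTo-∷ʳ h))) (map-++ (k ,_) (upTo h) (h ∷ []))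

leftmostTower : ∀ k T → 1 ≤ sum T → LeftmostTower k T
leftmostTower k (zero ∷ T) 1≤ΣT = record
  { gap = suc gap
  ; top = top
  ; labelling-removeLast = begin
      labellingFrom (suc k) T ++ []
        ≡⟨ ++-identityʳ _ ⟩
      labellingFrom (suc k) T
        ≡⟨ labelling-removeLast ⟩
      labellingFrom (suc k) (removeLast T) ++ (suc k + gap , top) ∷ []
        ≡⟨ cong₂ (λ w c → w ++ (c , top) ∷ []) (sym (++-identityʳ _)) (sym (+-suc k gap)) ⟩
      (labellingFrom (suc k) (removeLast T) ++ []) ++ (k + suc gap , top) ∷ [] ∎
  ; height-leftmost = height-leftmost
  ; height-removeLast-leftmost = height-removeLast-leftmost
  ; height-removeLast-other = λ { zero _ → refl ; (suc i) i≢ → height-removeLast-other i (i≢ ∘ cong suc) }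
  ; height-before-leftmost = λ { zero _ → refl ; (suc i) (s≤s i<) → height-before-leftmost i i< }
  }
  where
  open LeftmostTower (leftmostTower (suc k) T 1≤ΣT)
  open ≡-Reasoning
leftmostTower k (suc h ∷ T) _ = record
  { gap = 0
  ; top = h
  ; labelling-removeLast =
      trans (cong (labellingFrom (suc k) T ++_) (towerCells-snoc k h))
            (trans (sym (++-assoc (labellingFrom (suc k) T) (towerCells k h) _))
                   (cong (λ c → (labellingFrom (suc k) T ++ towerCells k h) ++ (c , h) ∷ []) (sym (+-identityʳ k))))
  ; height-leftmost = refl
  ; height-removeLast-leftmost = refl
  ; height-removeLast-other = λ { zero 0≢0 → ⊥-elim (0≢0 refl) ; (suc i) _ → refl }
  ; height-before-leftmost = λ _ ()
  }

length-labellingFrom : ∀ k T → length (labellingFrom k T) ≡ sum T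
length-labellingFrom k []      = refl
length-labellingFrom k (h ∷ T) = begin
  length (labellingFrom (suc k) T ++ towerCells k h)        ≡⟨ length-++ (labellingFrom (suc k) T) ⟩
  length (labellingFrom (suc k) T) + length (towerCells k h) ≡⟨ cong₂ _+_ (length-labellingFrom (suc k) T) (trans (length-map _ (upTo h)) (length-upTo h)) ⟩
  sum T + h                                                  ≡⟨ +-comm (sum T) h ⟩
  h + sum T                                                  ∎
  where open ≡-Reasoning

at-last : ∀ {A : Set} (xs : List A) x → at (xs ++ x ∷ []) (suc (length xs)) ≡ just x
at-last []            x = refl
at-last (y ∷ [])      x = refl
at-last (y ∷ z ∷ xs)  x = at-last (z ∷ xs) x

take-length-++ : ∀ {A : Set} (xs ys : List A) → take (length xs) (xs ++ ys) ≡ xs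
take-length-++ []       ys = refl
take-length-++ (x ∷ xs) ys = cong (x ∷_) (take-length-++ xs ys)

module _ {T : Diagram} (L : LeftmostTower 1 T) where
  open LeftmostTower L

  lastCell : Cell
  lastCell = (suc gap , top)

  lastLetter : ℕ
  lastLetter = suc gap + top

  naturalWord-removeLast : naturalWord T ≡ naturalWord (removeLast T) ++ lastLetter ∷ []
  naturalWord-removeLast =
    trans (cong (map cellSum) labelling-removeLast) (map-++ cellSum (labellingFrom 1 (removeLast T)) (lastCell ∷ []))

  sum≡1+length-removeLast : sum T ≡ suc (length (naturalLabelling (removeLast T)))
  sum≡1+length-removeLast = begin
    sum T                                                          ≡⟨ sym (length-labellingFrom 1 T) ⟩
    length (labellingFrom 1 T)                                     ≡⟨ cong length labelling-removeLast ⟩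
    length (naturalLabelling (removeLast T) ++ lastCell ∷ [])      ≡⟨ length-++ (naturalLabelling (removeLast T)) ⟩
    length (naturalLabelling (removeLast T)) + 1                   ≡⟨ +-comm _ 1 ⟩
    suc (length (naturalLabelling (removeLast T)))                 ∎
    where open ≡-Reasoning

  cellLabelled-last : ∀ {n} → n ≡ sum T → cellLabelled T n ≡ just lastCell
  cellLabelled-last refl = trans (cong₂ at labelling-removeLast sum≡1+length-removeLast) (at-last (naturalLabelling (removeLast T)) lastCell)

  naturalWord-last : ∀ {n} → n ≡ sum T → at (naturalWord T) n ≡ just lastLetter
  naturalWord-last refl =
    trans (cong₂ at naturalWord-removeLast (trans sum≡1+length-removeLast (cong suc (sym (length-map cellSum (naturalLabelling (removeLast T)))))))
          (at-last (naturalWord (removeLast T)) lastLetter)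

  take-naturalWord : ∀ {n} → n ≡ sum T → take (n ∸ 1) (naturalWord T) ≡ naturalWord (removeLast T)
  take-naturalWord refl =
    trans (cong₂ take (trans (cong (_∸ 1) sum≡1+length-removeLast) (sym (length-map cellSum (naturalLabelling (removeLast T))))) naturalWord-removeLast)
          (take-length-++ (naturalWord (removeLast T)) (lastLetter ∷ []))

  cells-removeLast : ∀ i j → (i , j) ∈ᵀ removeLast T ⇔ ((i , j) ∈ᵀ T × (i , j) ≢ lastCell)
  cells-removeLast zero    j = mk⇔ (λ ()) (λ { (() , _) })
  cells-removeLast (suc i) j with i ≟ gap
  ... | yes refl = mk⇔
          (λ j<top → let j<top' = subst (j <_) height-removeLast-leftmost j<top in
             subst (j <_) (sym height-leftmost) (m<n⇒m<1+n j<top') , λ c≡ → <-irrefl (cong proj₂ c≡) j<top')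
          (λ (j<1+top , j≢top) → subst (j <_) (sym height-removeLast-leftmost)
             (≤∧≢⇒< (≤-pred (subst (j <_) height-leftmost j<1+top)) (j≢top ∘ cong (suc gap ,_))))
  ... | no i≢gap = mk⇔
          (λ j< → subst (j <_) (height-removeLast-other i i≢gap) j< , λ c≡ → i≢gap (suc-injective (cong proj₁ c≡)))
          (λ (j< , _) → subst (j <_) (sym (height-removeLast-other i i≢gap)) j<)

  towers-before-leftmost-removeLast : ∀ k → InRange 1 (suc gap) k → height (removeLast T) k ≡ 0
  towers-before-leftmost-removeLast (suc i) (_ , s≤s i<gap) =
    trans (height-removeLast-other i (<⇒≢ i<gap)) (height-before-leftmost i i<gap)

tower-empty-by-inverse : ∀ V e (ρ : ℕ → ℕ) → 1 ≤ e → (∀ y → ρ (act (naturalWord V) y) ≡ y) →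
  (∀ j → e < j → ρ e < ρ j) → height V e ≡ 0
tower-empty-by-inverse V e ρ 1≤e ρ∘π≡id increasing with height V e in he
... | zero  = refl
... | suc _ with nonempty-tower-inversion V e 1≤e (subst (1 ≤_) (sym he) (s≤s z≤n))
...   | x , y , y<x , πx≡e , e<πy = ⊥-elim (<-asym y<x (subst₂ _<_ ρe≡x (ρ∘π≡id y) (increasing _ e<πy)))
  where
  ρe≡x : ρ e ≡ x
  ρe≡x = trans (cong ρ (sym πx≡e)) (ρ∘π≡id x)

module _ {T : Diagram} (L : LeftmostTower 1 T) where
  open LeftmostTower L

  private
    T⁻ = removeLast T
    e  = lastLetter L

    act-naturalWord-removeLast : ∀ x → act (naturalWord T) (swap e x) ≡ act (naturalWord T⁻) x
    act-naturalWord-removeLast x = begin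
      act (naturalWord T) (swap e x)                 ≡⟨ cong (λ w → act w (swap e x)) (naturalWord-removeLast L) ⟩
      act (naturalWord T⁻ ++ e ∷ []) (swap e x)      ≡⟨ act-++ (naturalWord T⁻) (e ∷ []) (swap e x) ⟩
      act (naturalWord T⁻) (swap e (swap e x))       ≡⟨ cong (act (naturalWord T⁻)) (swap-involutive e x) ⟩
      act (naturalWord T⁻) x                         ∎
      where open ≡-Reasoning

  removeLast-by-permutation : ∀ T' → (∀ x → act (naturalWord T') x ≡ act (naturalWord T) (swap e x)) →
    ∀ i j → (i , j) ∈ᵀ T' ⇔ ((i , j) ∈ᵀ T × (i , j) ≢ lastCell L)
  removeLast-by-permutation T' eq i j =
    subst (λ h → (j < h) ⇔ ((i , j) ∈ᵀ T × (i , j) ≢ lastCell L)) (sym (same-heights i)) (cells-removeLast L i j)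
    where
    same-heights : ∀ k → height T' k ≡ height T⁻ k
    same-heights = naturalWord-injective T' T⁻ (λ x → trans (eq x) (act-naturalWord-removeLast x))

  reverse-removeLast-shift : ∀ U U' → (∀ x → act (naturalWord U) x ≡ act (reverse (naturalWord T)) x) →
    (∀ x → act (naturalWord U') x ≡ act (reverse (naturalWord T⁻)) x) →
    ∀ a b → (a , b) ∈ᵀ U' ⇔ (((a , b) ∈ᵀ U × a ≢ e) ⊎ (a ≡ suc e × (e , suc b) ∈ᵀ U))
  reverse-removeLast-shift U U' eqU eqU' =
    shiftTower-cells (height U) (height U') e U'e≡0 (height-shiftTower U U' e (s≤s z≤n) U'e≡0 eq-shift)
    where
    ρ = act (naturalWord T⁻)
    empty = towers-before-leftmost-removeLast L
    e≡top : e ≡ suc gap + height T⁻ (suc gap)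
    e≡top = cong (suc gap +_) (sym height-removeLast-leftmost)
    ρe≡ : ρ e ≡ suc gap
    ρe≡ = trans (cong ρ e≡top) (act-naturalWord-leftmost-top T⁻ (suc gap) (s≤s z≤n) empty)
    increasing : ∀ j → e < j → ρ e < ρ j
    increasing j e<j = subst (_< ρ j) (sym ρe≡)
      (act-naturalWord-above-leftmost-top T⁻ (suc gap) (s≤s z≤n) empty j (subst (_< j) e≡top e<j))
    U'e≡0 : height U' e ≡ 0
    U'e≡0 = tower-empty-by-inverse U' e ρ (s≤s z≤n)
      (λ y → trans (cong ρ (eqU' y)) (act-reverseʳ (naturalWord T⁻) y)) increasing
    eq-shift : ∀ x → act (naturalWord U) x ≡ swap e (act (naturalWord U') x)
    eq-shift x = begin
      act (naturalWord U) x                         ≡⟨ eqU x ⟩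
      act (reverse (naturalWord T)) x               ≡⟨ cong (λ w → act (reverse w) x) (naturalWord-removeLast L) ⟩
      act (reverse (naturalWord T⁻ ++ e ∷ [])) x    ≡⟨ cong (λ w → act w x) (reverse-++ (naturalWord T⁻) (e ∷ [])) ⟩
      swap e (act (reverse (naturalWord T⁻)) x)     ≡⟨ cong (swap e) (sym (eqU' x)) ⟩
      swap e (act (naturalWord U') x)               ∎
      where open ≡-Reasoning

naturalWord-positive : ∀ T → PositiveLetters (naturalWord T)
naturalWord-positive T =
  subst PositiveLetters (sym (naturalWord-towers T _ ≤-refl)) (towers-lower-bound (height T) 1 (suc (length T)))

slides-reverse-naturalWord : ∀ {T U} → Slides (reverse (naturalWord T)) U →
  ∀ x → act (naturalWord U) x ≡ act (reverse (naturalWord T)) x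
slides-reverse-naturalWord {T} s = slides-naturalWord s (All-reverse (naturalWord-positive T))

proposition7p5 : (ω : ℕ → ℕ) (r : Word) → ReducedWord ω r → 1 ≤ length r →
    (T : Diagram) → Slides r T →
    Σ Cell λ c → Σ ℕ λ ηl →
      cellLabelled T (length r) ≡ just c ×
      at (naturalWord T) (length r) ≡ just ηl ×
      ((r' : Word) → ReducedWord (λ n → ω (swap ηl n)) r' →
        (T' : Diagram) → Slides r' T' →
        ∀ i j → ((i , j) ∈ᵀ T') ⇔ (((i , j) ∈ᵀ T) × ((i , j) ≢ c))) ×
      ((U U' : Diagram) → Slides (reverse (naturalWord T)) U →
        Slides (reverse (take (length r ∸ 1) (naturalWord T))) U' →
        ∀ a b → ((a , b) ∈ᵀ U') ⇔
          ((((a , b) ∈ᵀ U) × (a ≢ ηl)) ⊎ ((a ≡ suc ηl) × ((ηl , suc b) ∈ᵀ U))))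
proposition7p5 ω r (pos , rep , _) 1≤|r| T sl =
  lastCell L , e , cellLabelled-last L |r|≡ΣT , naturalWord-last L |r|≡ΣT , part₁ , part₂
  where
  |r|≡ΣT : length r ≡ sum T
  |r|≡ΣT = trans (sym (+-identityʳ _)) (sym (slides-sum sl pos))
  L = leftmostTower 1 T (subst (1 ≤_) |r|≡ΣT 1≤|r|)
  e = lastLetter L
  part₁ : (r' : Word) → ReducedWord (λ n → ω (swap e n)) r' → (T' : Diagram) → Slides r' T' →
    ∀ i j → ((i , j) ∈ᵀ T') ⇔ (((i , j) ∈ᵀ T) × ((i , j) ≢ lastCell L))
  part₁ r' (pos' , rep' , _) T' sl' = removeLast-by-permutation L T' λ x →
    trans (slides-naturalWord sl' pos' x) (trans (rep' x) (sym (trans (slides-naturalWord sl pos (swap e x)) (rep (swap e x)))))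
  part₂ : (U U' : Diagram) → Slides (reverse (naturalWord T)) U → Slides (reverse (take (length r ∸ 1) (naturalWord T))) U' →
    ∀ a b → ((a , b) ∈ᵀ U') ⇔ ((((a , b) ∈ᵀ U) × (a ≢ e)) ⊎ ((a ≡ suc e) × ((e , suc b) ∈ᵀ U)))
  part₂ U U' slU slU' = reverse-removeLast-shift L U U' (slides-reverse-naturalWord {T} slU)
    (slides-reverse-naturalWord {removeLast T} (subst (λ w → Slides (reverse w) U') (take-naturalWord L |r|≡ΣT) slU'))
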